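{- Let $m,n$ be positive integers with $m>n$ and let $q>1$ be an integer. If $X,y_1,y_2$ are positive integers with $X>1$, $\gcd(X,q)=1$, $y_1>y_2$ and $X^m-X^n=q^{y_1}-q^{y_2}$, then $m\equiv n\pmod{e_q(X)}$.
   Context: For a positive integer $M$ and an integer $A$ coprime to $M$, $e_M(A)$ is the least positive integer $e$ such that $A^e\equiv 1$ or $A^e\equiv -1\pmod M$. -}

module Defs where

open import Data.Nat using (ℕ; _+_; _^_; _%_; _<_; _≤_; NonZero)
open import Data.Nat.Divisibility using (_∣_)
open import Data.Sum using (_⊎_)
open import Data.Product using (_×_)
open import Relation.Binary.PropositionalEquality using (_≡_)

PlusMinusOne : (M A e : ℕ) → .{{_ : NonZero M}} → Set
PlusMinusOne M A e = (A ^ e % M ≡ 1 % M) ⊎ (M ∣ A ^ e + 1)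

IsE : (M A e : ℕ) → .{{_ : NonZero M}} → Set
IsE M A e = (0 < e) × PlusMinusOne M A e × (∀ f → 0 < f → PlusMinusOne M A f → e ≤ f)

-- Modulo q both powers of q vanish, so X^m ≡ X^n; as X is a unit mod q this gives
-- X^(m-n) ≡ 1. Writing m - n = r + k·e with e = e_q(X) and r < e, the factor
-- (X^e)^k is ±1 mod q, hence so is X^r, and minimality of e forces r = 0.
module Submission where

open import Defs
open import Data.Nat using (ℕ; zero; suc; _+_; _*_; _∸_; _^_; _%_; _/_; _<_; _≤_; NonZero; >-nonZero; z<s)
open import Data.Nat.Properties
open import Data.Nat.DivMod using (m≡m%n+[m/n]*n; m%n<n; [m+kn]%n≡m%n; m*n%n≡0; %-distribˡ-+; %-distribˡ-*)
open import Data.Nat.Divisibility using (_∣_; divides; m%n≡0⇒n∣m; n∣m⇒m%n≡0)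
open import Data.Nat.GCD using (gcd; module Bézout)
open import Data.Nat.Coprimality using (Coprime; gcd≡1⇒coprime; coprime-Bézout)
open import Data.Nat.Tactic.RingSolver using (solve-∀)
open import Data.Product using (∃; _,_)
open import Data.Sum using (_⊎_; inj₁; inj₂)
open import Relation.Binary.Bundles using (Setoid)
open import Relation.Binary.Structures using (IsEquivalence)
import Relation.Binary.Reasoning.Setoid as SetoidReasoning
open import Relation.Binary.PropositionalEquality as ≡ using (_≡_; cong; cong₂)
open import Relation.Nullary using (contradiction)

∣m∸n⇒m%e≡n%e : ∀ {m n e} .{{_ : NonZero e}} → n ≤ m → e ∣ m ∸ n → m % e ≡ n % e
∣m∸n⇒m%e≡n%e {m} {n} {e} n≤m (divides k m∸n≡k*e) = begin
  m % e             ≡⟨ cong (_% e) (m+[n∸m]≡n n≤m) ⟨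
  (n + (m ∸ n)) % e ≡⟨ cong (λ d → (n + d) % e) m∸n≡k*e ⟩
  (n + k * e) % e   ≡⟨ [m+kn]%n≡m%n n k e ⟩
  n % e             ∎
  where open ≡.≡-Reasoning

module Modulo (q : ℕ) .{{_ : NonZero q}} where

  infix 4 _≈_
  record _≈_ (a b : ℕ) : Set where
    constructor mk≈
    field
      %-≡ : a % q ≡ b % q

  ≈-isEquivalence : IsEquivalence _≈_
  ≈-isEquivalence = record
    { refl  = mk≈ ≡.refl
    ; sym   = λ (mk≈ p) → mk≈ (≡.sym p)
    ; trans = λ (mk≈ p) (mk≈ r) → mk≈ (≡.trans p r)
    }

  ≈-setoid : Setoid _ _
  ≈-setoid = record { isEquivalence = ≈-isEquivalence }

  open Setoid ≈-setoid public using () renaming (refl to ≈-refl; trans to ≈-trans; reflexive to ≈-reflexive)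
  module ≈-Reasoning = SetoidReasoning ≈-setoid

  +-cong : ∀ {a b c d} → a ≈ b → c ≈ d → a + c ≈ b + d
  +-cong {a} {b} {c} {d} (mk≈ a≈b) (mk≈ c≈d) = mk≈ (begin
    (a + c) % q             ≡⟨ %-distribˡ-+ a c q ⟩
    (a % q + c % q) % q     ≡⟨ cong₂ (λ u v → (u + v) % q) a≈b c≈d ⟩
    (b % q + d % q) % q     ≡⟨ %-distribˡ-+ b d q ⟨
    (b + d) % q             ∎)
    where open ≡.≡-Reasoning

  *-cong : ∀ {a b c d} → a ≈ b → c ≈ d → a * c ≈ b * d
  *-cong {a} {b} {c} {d} (mk≈ a≈b) (mk≈ c≈d) = mk≈ (begin
    (a * c) % q             ≡⟨ %-distribˡ-* a c q ⟩
    (a % q * (c % q)) % q   ≡⟨ cong₂ (λ u v → (u * v) % q) a≈b c≈d ⟩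
    (b % q * (d % q)) % q   ≡⟨ %-distribˡ-* b d q ⟨
    (b * d) % q             ∎)
    where open ≡.≡-Reasoning

  0%q≡0 : 0 % q ≡ 0
  0%q≡0 = m*n%n≡0 0 q

  ∣⇒≈0 : ∀ {a} → q ∣ a → a ≈ 0
  ∣⇒≈0 {a} q∣a = mk≈ (≡.trans (n∣m⇒m%n≡0 a q q∣a) (≡.sym 0%q≡0))

  ≈0⇒∣ : ∀ {a} → a ≈ 0 → q ∣ a
  ≈0⇒∣ {a} (mk≈ a%q≡0%q) = m%n≡0⇒n∣m a q (≡.trans a%q≡0%q 0%q≡0)

  0<k⇒q^k≈0 : ∀ {k} → 0 < k → q ^ k ≈ 0
  0<k⇒q^k≈0 {suc k} _ = ∣⇒≈0 (divides (q ^ k) (*-comm q (q ^ k)))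

  +-multiple≈ : ∀ a k → a + k * q ≈ a
  +-multiple≈ a k = mk≈ ([m+kn]%n≡m%n a k q)

  -- -1 is encoded by a + 1 ≈ 0, so that no subtraction is needed.
  infix 4 _≈±1
  _≈±1 : ℕ → Set
  a ≈±1 = a ≈ 1 ⊎ a + 1 ≈ 0

  ≈±1-resp : ∀ {a b} → a ≈ b → b ≈±1 → a ≈±1
  ≈±1-resp a≈b (inj₁ b≈1)   = inj₁ (≈-trans a≈b b≈1)
  ≈±1-resp a≈b (inj₂ b+1≈0) = inj₂ (≈-trans (+-cong a≈b ≈-refl) b+1≈0)

  +1≈0⇒*≈1 : ∀ {a b} → a + 1 ≈ 0 → b + 1 ≈ 0 → a * b ≈ 1
  +1≈0⇒*≈1 {a} {b} a+1≈0 b+1≈0 = begin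
    a * b                       ≡⟨ +-identityʳ (a * b) ⟨
    a * b + 0                   ≈⟨ +-cong ≈-refl (+-cong a+1≈0 b+1≈0) ⟨
    a * b + ((a + 1) + (b + 1)) ≡⟨ expand a b ⟩
    (a + 1) * (b + 1) + 1       ≈⟨ +-cong (*-cong a+1≈0 b+1≈0) ≈-refl ⟩
    1                           ∎
    where
    open ≈-Reasoning
    expand : ∀ a b → a * b + ((a + 1) + (b + 1)) ≡ (a + 1) * (b + 1) + 1
    expand = solve-∀

  *-≈±1 : ∀ {a b} → a ≈±1 → b ≈±1 → a * b ≈±1
  *-≈±1 (inj₁ a≈1) (inj₁ b≈1) = inj₁ (*-cong a≈1 b≈1)
  *-≈±1 {a} {b} (inj₁ a≈1) (inj₂ b+1≈0) = inj₂ (begin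
    a * b + 1 ≈⟨ +-cong (*-cong a≈1 ≈-refl) ≈-refl ⟩
    1 * b + 1 ≡⟨ cong (_+ 1) (*-identityˡ b) ⟩
    b + 1     ≈⟨ b+1≈0 ⟩
    0         ∎)
    where open ≈-Reasoning
  *-≈±1 {a} {b} (inj₂ a+1≈0) (inj₁ b≈1) = inj₂ (begin
    a * b + 1 ≈⟨ +-cong (*-cong (≈-refl {a}) b≈1) ≈-refl ⟩
    a * 1 + 1 ≡⟨ cong (_+ 1) (*-identityʳ a) ⟩
    a + 1     ≈⟨ a+1≈0 ⟩
    0         ∎)
    where open ≈-Reasoning
  *-≈±1 (inj₂ a+1≈0) (inj₂ b+1≈0) = inj₁ (+1≈0⇒*≈1 a+1≈0 b+1≈0)

  ^-≈±1 : ∀ {a} → a ≈±1 → ∀ k → a ^ k ≈±1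
  ^-≈±1 a≈±1 zero    = inj₁ ≈-refl
  ^-≈±1 a≈±1 (suc k) = *-≈±1 a≈±1 (^-≈±1 a≈±1 k)

  ≈±1⇒*-self≈1 : ∀ {a} → a ≈±1 → a * a ≈ 1
  ≈±1⇒*-self≈1 (inj₁ a≈1)   = *-cong a≈1 a≈1
  ≈±1⇒*-self≈1 (inj₂ a+1≈0) = +1≈0⇒*≈1 a+1≈0 a+1≈0

  ≈±1-cancelʳ : ∀ {a b} → a * b ≈±1 → b ≈±1 → a ≈±1
  ≈±1-cancelʳ {a} {b} ab≈±1 b≈±1 = ≈±1-resp a≈a*b*b (*-≈±1 ab≈±1 b≈±1)
    where
    open ≈-Reasoning
    a≈a*b*b : a ≈ a * b * b
    a≈a*b*b = begin
      a           ≡⟨ *-identityʳ a ⟨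
      a * 1       ≈⟨ *-cong (≈-refl {a}) (≈±1⇒*-self≈1 b≈±1) ⟨
      a * (b * b) ≡⟨ *-assoc a b b ⟨
      a * b * b   ∎

  Invertible : ℕ → Set
  Invertible a = ∃ λ b → a * b ≈ 1

  coprime⇒invertible : ∀ {a} → Coprime a q → Invertible a
  coprime⇒invertible {a} a⊥q with coprime-Bézout a⊥q
  ... | Bézout.+- x y 1+yq≡xa = x , (begin
    a * x     ≡⟨ *-comm a x ⟩
    x * a     ≡⟨ 1+yq≡xa ⟨
    1 + y * q ≈⟨ +-multiple≈ 1 y ⟩
    1         ∎)
    where open ≈-Reasoning
  ... | Bézout.-+ x y 1+xa≡yq = x * x * a , (begin
    a * (x * x * a)   ≡⟨ regroup a x ⟩
    (x * a) * (x * a) ≈⟨ +1≈0⇒*≈1 xa+1≈0 xa+1≈0 ⟩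
    1                 ∎)
    where
    open ≈-Reasoning
    regroup : ∀ a x → a * (x * x * a) ≡ (x * a) * (x * a)
    regroup = solve-∀
    -- x·a ≡ -1, so its square x·x·a·a ≡ 1 exhibits x·x·a as the inverse.
    xa+1≈0 : x * a + 1 ≈ 0
    xa+1≈0 = begin
      x * a + 1 ≡⟨ +-comm (x * a) 1 ⟩
      1 + x * a ≡⟨ 1+xa≡yq ⟩
      y * q     ≈⟨ +-multiple≈ 0 y ⟩
      0         ∎

  ^-invertible : ∀ {a} → Invertible a → ∀ n → Invertible (a ^ n)
  ^-invertible _ zero = 1 , ≈-refl
  ^-invertible {a} (b , ab≈1) (suc n) with ^-invertible (b , ab≈1) n
  ... | c , aⁿc≈1 = b * c , (begin
    a * a ^ n * (b * c)   ≡⟨ regroup a (a ^ n) b c ⟩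
    (a * b) * (a ^ n * c) ≈⟨ *-cong ab≈1 aⁿc≈1 ⟩
    1                     ∎)
    where
    open ≈-Reasoning
    regroup : ∀ a u b c → a * u * (b * c) ≡ (a * b) * (u * c)
    regroup = solve-∀

  invertible-cancelˡ : ∀ {a b c} → Invertible a → a * b ≈ a * c → b ≈ c
  invertible-cancelˡ {a} {b} {c} (a⁻¹ , aa⁻¹≈1) ab≈ac = begin
    b             ≡⟨ *-identityˡ b ⟨
    1 * b         ≈⟨ *-cong aa⁻¹≈1 ≈-refl ⟨
    a * a⁻¹ * b   ≡⟨ regroup a a⁻¹ b ⟩
    a⁻¹ * (a * b) ≈⟨ *-cong (≈-refl {a⁻¹}) ab≈ac ⟩
    a⁻¹ * (a * c) ≡⟨ regroup a a⁻¹ c ⟨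
    a * a⁻¹ * c   ≈⟨ *-cong aa⁻¹≈1 ≈-refl ⟩
    1 * c         ≡⟨ *-identityˡ c ⟩
    c             ∎
    where
    open ≈-Reasoning
    regroup : ∀ a a⁻¹ b → a * a⁻¹ * b ≡ a⁻¹ * (a * b)
    regroup = solve-∀

  ^-cancel : ∀ {a m n} → Invertible a → n ≤ m → a ^ m ≈ a ^ n → a ^ (m ∸ n) ≈ 1
  ^-cancel {a} {m} {n} a-inv n≤m aᵐ≈aⁿ = invertible-cancelˡ {a ^ n} (^-invertible {a} a-inv n) (begin
    a ^ n * a ^ (m ∸ n) ≡⟨ ^-distribˡ-+-* a n (m ∸ n) ⟨
    a ^ (n + (m ∸ n))   ≡⟨ cong (a ^_) (m+[n∸m]≡n n≤m) ⟩
    a ^ m               ≈⟨ aᵐ≈aⁿ ⟩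
    a ^ n               ≡⟨ *-identityʳ (a ^ n) ⟨
    a ^ n * 1           ∎)
    where open ≈-Reasoning

  PlusMinusOne⇒≈±1 : ∀ {a e} → PlusMinusOne q a e → a ^ e ≈±1
  PlusMinusOne⇒≈±1 (inj₁ aᵉ%q≡1%q) = inj₁ (mk≈ aᵉ%q≡1%q)
  PlusMinusOne⇒≈±1 (inj₂ q∣aᵉ+1)   = inj₂ (∣⇒≈0 q∣aᵉ+1)

  ≈±1⇒PlusMinusOne : ∀ {a e} → a ^ e ≈±1 → PlusMinusOne q a e
  ≈±1⇒PlusMinusOne (inj₁ (mk≈ aᵉ%q≡1%q)) = inj₁ aᵉ%q≡1%q
  ≈±1⇒PlusMinusOne (inj₂ aᵉ+1≈0)         = inj₂ (≈0⇒∣ aᵉ+1≈0)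

  IsE⇒∣ : ∀ {a e d} → IsE q a e → a ^ d ≈±1 → e ∣ d
  IsE⇒∣ {a} {e} {d} (0<e , aᵉ≈±1 , minimal) aᵈ≈±1 =
    m%n≡0⇒n∣m d e (below-e⇒≡0 r (≈±1⇒PlusMinusOne {a} {r} aʳ≈±1) (m%n<n d e))
    where
    instance
      e≢0 : NonZero e
      e≢0 = >-nonZero 0<e

    r k : ℕ
    r = d % e
    k = d / e

    aʳ*[aᵉ]ᵏ≡aᵈ : a ^ r * (a ^ e) ^ k ≡ a ^ d
    aʳ*[aᵉ]ᵏ≡aᵈ = begin
      a ^ r * (a ^ e) ^ k ≡⟨ cong (a ^ r *_) (^-*-assoc a e k) ⟩
      a ^ r * a ^ (e * k) ≡⟨ cong (λ i → a ^ r * a ^ i) (*-comm e k) ⟩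
      a ^ r * a ^ (k * e) ≡⟨ ^-distribˡ-+-* a r (k * e) ⟨
      a ^ (r + k * e)     ≡⟨ cong (a ^_) (m≡m%n+[m/n]*n d e) ⟨
      a ^ d               ∎
      where open ≡.≡-Reasoning

    aʳ≈±1 : a ^ r ≈±1
    aʳ≈±1 = ≈±1-cancelʳ (≈±1-resp (≈-reflexive aʳ*[aᵉ]ᵏ≡aᵈ) aᵈ≈±1)
                         (^-≈±1 (PlusMinusOne⇒≈±1 {a} {e} aᵉ≈±1) k)

    below-e⇒≡0 : ∀ t → PlusMinusOne q a t → t < e → t ≡ 0
    below-e⇒≡0 zero    _    _   = ≡.refl
    below-e⇒≡0 (suc t) aᵗ≈±1 t<e = contradiction (minimal (suc t) z<s aᵗ≈±1) (<⇒≱ t<e)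

lemma11p2 : (m n q X y₁ y₂ e : ℕ) → .{{_ : NonZero q}} → 0 < n → n < m → 1 < q →
    1 < X → gcd X q ≡ 1 → 0 < y₂ → y₂ < y₁ →
    X ^ m + q ^ y₂ ≡ q ^ y₁ + X ^ n →
    IsE q X e → .{{_ : NonZero e}} → m % e ≡ n % e
lemma11p2 m n q X y₁ y₂ e _ n<m _ _ gcd≡1 0<y₂ y₂<y₁ eq isE =
  ∣m∸n⇒m%e≡n%e n≤m (IsE⇒∣ isE (inj₁ Xᵐ⁻ⁿ≈1))
  where
  open Modulo q
  open ≈-Reasoning

  n≤m : n ≤ m
  n≤m = <⇒≤ n<m

  Xᵐ≈Xⁿ : X ^ m ≈ X ^ n
  Xᵐ≈Xⁿ = begin
    X ^ m          ≡⟨ +-identityʳ (X ^ m) ⟨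
    X ^ m + 0      ≈⟨ +-cong (≈-refl {X ^ m}) (0<k⇒q^k≈0 0<y₂) ⟨
    X ^ m + q ^ y₂ ≡⟨ eq ⟩
    q ^ y₁ + X ^ n ≈⟨ +-cong (0<k⇒q^k≈0 (<-trans 0<y₂ y₂<y₁)) ≈-refl ⟩
    X ^ n          ∎

  Xᵐ⁻ⁿ≈1 : X ^ (m ∸ n) ≈ 1
  Xᵐ⁻ⁿ≈1 = ^-cancel (coprime⇒invertible {X} (gcd≡1⇒coprime gcd≡1)) n≤m Xᵐ≈Xⁿ
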